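{- If $T$ is a tree of order $n$, then $\iota_{\rm g}(T)\le \frac{1}{2}n$, with equality if and only if $T=K_2$.
   Context: For a graph $G$ and $X\subseteq V(G)$, $N_G[X]$ denotes the set of vertices in $X$ or adjacent to a vertex of $X$. The isolation game on a finite graph $G$ is played by two players, Dominator and Staller, who alternately select vertices of $G$. If $X$ is the set of vertices selected so far, a vertex $x$ may be selected (is playable) only if $x$ dominates (i.e., equals or is adjacent to) some vertex belonging to a component of $G - N_G[X]$ with at least two vertices. The game ends when no playable vertex exists. Dominator aims to minimize the total number of selected vertices, Staller aims to maximize it. The game isolation number $\iota_{\rm g}(G)$ is the number of vertices selected when Dominator makes the first move and both play optimally. -}

module Defs where

open import Data.Bool using (Bool; true; false; not; _∧_; _∨_; T)
open import Data.Nat using (ℕ; zero; suc; _⊓_; _⊔_; _≤_)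
open import Data.Fin using (Fin; _≟_)
open import Data.Fin.Subset using (Subset; ⁅_⁆; _∪_) renaming (⊥ to ∅)
open import Data.Vec using (lookup)
open import Data.List using (List; []; _∷_; map; foldr; length; allFin; filterᵇ)
open import Data.Bool.ListAction using (any)
open import Data.List.Relation.Unary.Unique.Propositional using (Unique)
open import Data.Product using (Σ; _×_; Σ-syntax)
open import Data.Unit using (⊤)
open import Data.Empty using () renaming (⊥ to Empty)
open import Relation.Nullary using (¬_; does)
open import Relation.Binary.PropositionalEquality using (_≡_; refl)
open import Function.Bundles using (_⤖_; Bijection)

record Graph (n : ℕ) : Set where
  field
    adj        : Fin n → Fin n → Bool
    adj-sym    : ∀ u v → adj u v ≡ adj v u
    adj-irrefl : ∀ v → adj v v ≡ false
open Graph public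

anyV : ∀ {n} → (Fin n → Bool) → Bool
anyV {n} p = any p (allFin n)

module _ {n : ℕ} (G : Graph n) where

  dom : Fin n → Fin n → Bool
  dom x v = does (x ≟ v) ∨ adj G x v

  inN : Subset n → Fin n → Bool
  inN X v = anyV (λ x → lookup X x ∧ dom x v)

  -- v is a vertex of G - N_G[X] whose component in G - N_G[X] has at least
  -- two vertices, i.e. v is not an isolated vertex of G - N_G[X]
  inBigComp : Subset n → Fin n → Bool
  inBigComp X v = not (inN X v) ∧ anyV (λ u → adj G v u ∧ not (inN X u))

  playable : Subset n → Fin n → Bool
  playable X x = anyV (λ v → dom x v ∧ inBigComp X v)

  playableList : Subset n → List (Fin n)
  playableList X = filterᵇ (playable X) (allFin n)

data Player : Set where
  Dominator Staller : Player

other : Player → Player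
other Dominator = Staller
other Staller   = Dominator

opt : Player → ℕ → List ℕ → ℕ
opt Dominator a xs = foldr _⊓_ a xs
opt Staller   a xs = foldr _⊔_ a xs

module _ {n : ℕ} (G : Graph n) where

  value : ℕ → Player → Subset n → ℕ
  value zero    p X = 0
  value (suc f) p X = go (playableList G X)
    where
    next : Fin n → ℕ
    next x = value f (other p) (X ∪ ⁅ x ⁆)
    go : List (Fin n) → ℕ
    go []       = 0
    go (x ∷ xs) = suc (opt p (next x) (map next xs))

  -- game isolation number: Dominator starts from the empty position.
  -- Every playable vertex is unselected, so the game has at most n moves
  -- and fuel n suffices.
  ιg : ℕ
  ιg = value n Dominator ∅

module _ {n : ℕ} (G : Graph n) where

  data Walk : Fin n → Fin n → Set where
    here : ∀ {v} → Walk v v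
    step : ∀ {u w v} → T (adj G u w) → Walk w v → Walk u v

  Connected : Set
  Connected = ∀ u v → Walk u v

  closedChain : Fin n → List (Fin n) → Set
  closedChain f []            = ⊤
  closedChain f (a ∷ [])      = T (adj G a f)
  closedChain f (a ∷ b ∷ r)   = T (adj G a b) × closedChain f (b ∷ r)

  CyclicAdj : List (Fin n) → Set
  CyclicAdj []       = Empty
  CyclicAdj (v ∷ vs) = closedChain v (v ∷ vs)

  IsCycle : List (Fin n) → Set
  IsCycle vs = (3 ≤ length vs) × Unique vs × CyclicAdj vs

  Acyclic : Set
  Acyclic = ¬ (Σ[ vs ∈ List (Fin n) ] IsCycle vs)

  record IsTree : Set where
    field
      nonempty  : 1 ≤ n
      connected : Connected
      acyclic   : Acyclic

_≅_ : ∀ {n m} → Graph n → Graph m → Set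
_≅_ {n} {m} G H =
  Σ[ f ∈ Fin n ⤖ Fin m ] (∀ u v → adj G u v ≡ adj H (Bijection.to f u) (Bijection.to f v))

K₂ : Graph 2
K₂ = record { adj = λ u v → not (does (u ≟ v)) ; adj-sym = s ; adj-irrefl = i }
  where
  s : ∀ (u v : Fin 2) → not (does (u ≟ v)) ≡ not (does (v ≟ u))
  s Fin.zero Fin.zero = refl
  s Fin.zero (Fin.suc Fin.zero) = refl
  s (Fin.suc Fin.zero) Fin.zero = refl
  s (Fin.suc Fin.zero) (Fin.suc Fin.zero) = refl
  i : ∀ (v : Fin 2) → not (does (v ≟ v)) ≡ false
  i Fin.zero = refl
  i (Fin.suc Fin.zero) = refl

module Submission where

-- Call a vertex live, once the vertices X have been selected, if it lies in a component
-- of G - N[X] with at least two vertices, and let r(X) be the number of live vertices.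
-- Every move kills a live vertex. If no undominated vertex has two undominated neighbours
-- (all nontrivial residual components are K₂), every move kills two; otherwise Dominator
-- can play the centre of a residual P₃ and kill three. Induction on the play gives
-- 2·value ≤ r(X) with Dominator to move and 2·value ≤ r(X) + 1 with Staller to move,
-- hence 2 ιg(G) ≤ n for every graph.
-- A tree with at least four vertices has an opening that kills four vertices: a vertex
-- of degree three, or the neighbour c of the stem b of a leaf a when c has a neighbour
-- other than b (leaves exist, as a simple path in a leafless acyclic graph can always be
-- extended). This gives 2 ιg(T) < n, so equality forces n = 2, since n = 1, 3 are odd.

open import Data.Bool using (Bool; true; false; not; _∨_; T)
open import Data.Bool.Properties using (T-∧; T-∨; T-≡)
open import Data.Empty using (⊥-elim)
open import Data.Fin using (Fin; _≟_; toℕ)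
open import Data.Fin.Patterns using (0F; 1F)
open import Data.Fin.Permutation using (↔⇒≡)
open import Data.Fin.Properties using (any?)
open import Data.Fin.Subset using (Subset; ⁅_⁆; _∪_) renaming (⊥ to ∅; _∈_ to _∈ₛ_)
open import Data.Fin.Subset.Properties using (x∈⁅x⁆; x∈p∪q⁺; ∉⊥)
open import Data.List using (List; []; _∷_; length; map; take; allFin)
open import Data.List.Membership.Propositional using (_∈_; _∉_; lose)
open import Data.List.Membership.Propositional.Properties using (∈-allFin; ∈-filter⁺; ∈-filter⁻; ∈-map⁺)
open import Data.List.Properties using (foldr-preservesᵇ; foldr-preservesᵒ; length-tabulate)
open import Data.List.Relation.Binary.Subset.Propositional using (_⊆_)
open import Data.List.Relation.Unary.All as All using (All; []; _∷_)
open import Data.List.Relation.Unary.All.Properties as All using (¬Any⇒All¬)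
open import Data.List.Relation.Unary.AllPairs using ([]; _∷_)
open import Data.List.Relation.Unary.Any as Any using (Any; here; there; satisfied)
open import Data.List.Relation.Unary.Any.Properties using (any⁺; any⁻)
open import Data.List.Relation.Unary.Linked using (Linked; [-]; _∷_)
open import Data.List.Relation.Unary.Unique.Propositional using (Unique)
open import Data.List.Relation.Unary.Unique.Propositional.Properties using (take⁺; allFin⁺)
open import Data.Nat using (ℕ; zero; suc; _+_; _*_; _≤_; _<_; z≤n; s≤s)
open import Data.Nat.Properties renaming (_≟_ to _≟ℕ_)
open import Data.Product using (∃; ∃₂; _×_; _,_; proj₁; proj₂)
open import Data.Sum using (_⊎_; inj₁; inj₂; [_,_])
open import Data.Vec using (lookup)
open import Data.Vec.Properties using ([]=⇒lookup; lookup⇒[]=)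
open import Function using (_∘_; id)
open import Function.Bundles using (_⇔_; mk⇔; mk⤖; Equivalence)
open import Function.Properties.Bijection using (⤖⇒↔)
open import Relation.Binary.Definitions using (DecidableEquality)
open import Relation.Binary.PropositionalEquality using (_≡_; refl; sym; trans; subst)
open import Relation.Nullary using (¬_; Dec; does; yes; no)
open import Relation.Nullary.Decidable using (T?; ¬?; _×-dec_; decidable-stable)
open import Relation.Unary using (Decidable)

open import Defs

open Equivalence using (to; from)

T-not : ∀ {a} → T (not a) ⇔ (¬ T a)
T-not {true}  = mk⇔ (λ ()) (λ ¬t → ¬t _)
T-not {false} = mk⇔ (λ _ ()) _

anyV⇔ : ∀ {n} {p : Fin n → Bool} → T (anyV p) ⇔ ∃ λ x → T (p x)
anyV⇔ {n} {p} = mk⇔ (satisfied ∘ any⁻ p (allFin n)) (λ (x , px) → any⁺ p (lose (∈-allFin x) px))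

T-does⇔ : ∀ {A : Set} (a? : Dec A) → T (does a?) ⇔ A
T-does⇔ (yes a)  = mk⇔ (λ _ → a) _
T-does⇔ (no ¬a) = mk⇔ (λ ()) ¬a

lookup⇔∈ : ∀ {n} {X : Subset n} {x} → T (lookup X x) ⇔ x ∈ₛ X
lookup⇔∈ {X = X} {x} = mk⇔ (λ t → lookup⇒[]= x X (to T-≡ t)) (λ x∈X → from T-≡ ([]=⇒lookup x∈X))

module _ {A : Set} where

  count : (A → Bool) → List A → ℕ
  count p []       = 0
  count p (x ∷ xs) with p x
  ... | true  = suc (count p xs)
  ... | false = count p xs

  count≤length : ∀ p xs → count p xs ≤ length xs
  count≤length p []       = z≤n
  count≤length p (x ∷ xs) with p x
  ... | true  = s≤s (count≤length p xs)
  ... | false = m≤n⇒m≤1+n (count≤length p xs)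

  module _ {p q : A → Bool} (p⇒q : ∀ x → T (p x) → T (q x)) where

    private
      p∧¬q-absurd : ∀ {x} → p x ≡ true → q x ≡ false → ∀ {B : Set} → B
      p∧¬q-absurd {x} px qx = ⊥-elim (subst T qx (p⇒q x (from T-≡ px)))

    count-mono : ∀ xs → count p xs ≤ count q xs
    count-mono []       = z≤n
    count-mono (x ∷ xs) with p x in px | q x in qx
    ... | true  | true  = s≤s (count-mono xs)
    ... | true  | false = p∧¬q-absurd px qx
    ... | false | true  = m≤n⇒m≤1+n (count-mono xs)
    ... | false | false = count-mono xs

    count-mono-< : ∀ {d} xs → d ∈ xs → T (q d) → ¬ T (p d) → count p xs < count q xs
    count-mono-< (x ∷ xs) (here refl) qd ¬pd with p x | q x
    ... | true  | _     = ⊥-elim (¬pd _)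
    ... | false | true  = s≤s (count-mono xs)
    count-mono-< (x ∷ xs) (there d∈xs) qd ¬pd with p x in px | q x in qx
    ... | true  | true  = s≤s (count-mono-< xs d∈xs qd ¬pd)
    ... | true  | false = p∧¬q-absurd px qx
    ... | false | true  = m≤n⇒m≤1+n (count-mono-< xs d∈xs qd ¬pd)
    ... | false | false = count-mono-< xs d∈xs qd ¬pd

  count+length≤count : DecidableEquality A → ∀ {p q : A → Bool} → (∀ x → T (p x) → T (q x)) →
    ∀ xs ds → Unique ds → ds ⊆ xs → All (λ d → T (q d) × ¬ T (p d)) ds →
    count p xs + length ds ≤ count q xs
  count+length≤count _≟_ {p} {q} p⇒q xs [] _ _ _ =
    ≤-trans (≤-reflexive (+-identityʳ _)) (count-mono p⇒q xs)
  count+length≤count _≟_ {p} {q} p⇒q xs (d ∷ ds) (d∉ds ∷ uniq) ds⊆xs ((qd , ¬pd) ∷ rest) = begin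
    count p xs + suc (length ds)  ≡⟨ +-suc _ _ ⟩
    suc (count p xs) + length ds  ≤⟨ +-monoˡ-≤ _ (count-mono-< p⇒p′ xs (ds⊆xs (here refl)) p′d ¬pd) ⟩
    count p′ xs + length ds       ≤⟨ count+length≤count _≟_ p′⇒q xs ds uniq (ds⊆xs ∘ there)
                                       (All.zipWith fresh (d∉ds , rest)) ⟩
    count q xs                    ∎
    where
    open ≤-Reasoning
    -- Moving d into p strictly raises the count and leaves the rest of ds outside p.
    p′ : A → Bool
    p′ x = p x ∨ does (x ≟ d)
    p⇒p′ : ∀ x → T (p x) → T (p′ x)
    p⇒p′ x px = from T-∨ (inj₁ px)
    p′d : T (p′ d)
    p′d = from (T-∨ {p d}) (inj₂ (from (T-does⇔ (d ≟ d)) refl))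
    p′⇒q : ∀ x → T (p′ x) → T (q x)
    p′⇒q x p′x with to T-∨ p′x
    ... | inj₁ px  = p⇒q x px
    ... | inj₂ x≟d with refl ← to (T-does⇔ (x ≟ d)) x≟d = qd
    fresh : ∀ {x} → ¬ d ≡ x × (T (q x) × ¬ T (p x)) → T (q x) × ¬ T (p′ x)
    fresh {x} (d≢x , qx , ¬px) = qx , [ ¬px , d≢x ∘ sym ∘ to (T-does⇔ (x ≟ d)) ] ∘ to T-∨

unique-⊆⇒length≤ : ∀ {A : Set} → DecidableEquality A → ∀ {ds xs : List A} →
  Unique ds → ds ⊆ xs → length ds ≤ length xs
unique-⊆⇒length≤ _≟_ {ds} {xs} uniq ds⊆xs = begin
  length ds                          ≤⟨ m≤n+m _ _ ⟩
  count (λ _ → false) xs + length ds ≤⟨ count+length≤count _≟_ (λ _ ()) xs ds uniq ds⊆xs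
                                          (All.tabulate (λ _ → _ , λ ())) ⟩
  count (λ _ → true) xs              ≤⟨ count≤length _ xs ⟩
  length xs                          ∎
  where open ≤-Reasoning

takeThrough : ∀ {A : Set} {x : A} {xs} → x ∈ xs → List A
takeThrough {xs = xs} x∈xs = take (suc (toℕ (Any.index x∈xs))) xs

takeThrough-nonempty : ∀ {A : Set} {x : A} {xs} (x∈xs : x ∈ xs) → 1 ≤ length (takeThrough x∈xs)
takeThrough-nonempty (here _)  = s≤s z≤n
takeThrough-nonempty (there _) = s≤s z≤n

either-preserves : (P : ℕ → Set) {x y z : ℕ} → z ≡ x ⊎ z ≡ y → P x → P y → P z
either-preserves P (inj₁ refl) Px _  = Px
either-preserves P (inj₂ refl) _  Py = Py

opt-preserves : (P : ℕ → Set) → ∀ p {a ns} → P a → All P ns → P (opt p a ns)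
opt-preserves P Dominator = foldr-preservesᵇ {P = P} (λ {x} {y} → either-preserves P (⊓-sel x y))
opt-preserves P Staller   = foldr-preservesᵇ {P = P} (λ {x} {y} → either-preserves P (⊔-sel x y))

opt-Dominator-≤ : ∀ a ns {m} → m ∈ a ∷ ns → opt Dominator a ns ≤ m
opt-Dominator-≤ a ns {m} m∈ = foldr-preservesᵒ {P = _≤ m}
  (λ x y → [ ≤-trans (m⊓n≤m x y) , ≤-trans (m⊓n≤n x y) ]) a ns (some-≤ m∈)
  where
  some-≤ : m ∈ a ∷ ns → a ≤ m ⊎ Any (_≤ m) ns
  some-≤ (here refl)  = inj₁ ≤-refl
  some-≤ (there m∈ns) = inj₂ (Any.map (λ { refl → ≤-refl }) m∈ns)

module _ {n : ℕ} (G : Graph n) where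

  -- The residual graph

  Adj : Fin n → Fin n → Set
  Adj u v = T (adj G u v)

  Dominated : Subset n → Fin n → Set
  Dominated X v = T (inN G X v)

  Live : Subset n → Fin n → Set
  Live X v = T (inBigComp G X v)

  Playable : Subset n → Fin n → Set
  Playable X x = T (playable G X x)

  Killed : Subset n → Fin n → Fin n → Set
  Killed X y v = Live X v × ¬ Live (X ∪ ⁅ y ⁆) v

  Adj-sym : ∀ {u v} → Adj u v → Adj v u
  Adj-sym {u} {v} rewrite adj-sym G u v = id

  Adj⇒≢ : ∀ {u v} → Adj u v → ¬ u ≡ v
  Adj⇒≢ {u} uv refl rewrite adj-irrefl G u = uv

  dom-refl : ∀ x → T (dom G x x)
  dom-refl x = from T-∨ (inj₁ (from (T-does⇔ (x ≟ x)) refl))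

  dom-adj : ∀ x v → Adj x v → T (dom G x v)
  dom-adj x v xv = from T-∨ (inj₂ xv)

  dominated⇔ : ∀ X v → Dominated X v ⇔ ∃ λ x → x ∈ₛ X × T (dom G x v)
  dominated⇔ X v = mk⇔
    (λ d → let (x , t) = to anyV⇔ d ; (x∈X , xv) = to (T-∧ {lookup X x}) t in x , to lookup⇔∈ x∈X , xv)
    (λ (x , x∈X , xv) → from anyV⇔ (x , from T-∧ (from lookup⇔∈ x∈X , xv)))

  ¬dominated-∅ : ∀ v → ¬ Dominated ∅ v
  ¬dominated-∅ v d = let (_ , x∈∅ , _) = to (dominated⇔ ∅ v) d in ∉⊥ x∈∅

  dominated-∪ : ∀ X y v → Dominated X v → Dominated (X ∪ ⁅ y ⁆) v
  dominated-∪ X y v d = let (x , x∈X , xv) = to (dominated⇔ X v) d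
    in from (dominated⇔ (X ∪ ⁅ y ⁆) v) (x , x∈p∪q⁺ (inj₁ x∈X) , xv)

  dominated-new : ∀ X y v → T (dom G y v) → Dominated (X ∪ ⁅ y ⁆) v
  dominated-new X y v yv = from (dominated⇔ (X ∪ ⁅ y ⁆) v) (y , x∈p∪q⁺ (inj₂ (x∈⁅x⁆ y)) , yv)

  live⁻ : ∀ X v → Live X v → ¬ Dominated X v × ∃ λ u → Adj v u × ¬ Dominated X u
  live⁻ X v l = let (¬dv , t) = to T-∧ l ; (u , t′) = to anyV⇔ t ; (vu , ¬du) = to (T-∧ {adj G v u}) t′
    in to T-not ¬dv , u , vu , to T-not ¬du

  live⁺ : ∀ X v u → ¬ Dominated X v → Adj v u → ¬ Dominated X u → Live X v
  live⁺ X v u ¬dv vu ¬du = from T-∧ (from T-not ¬dv , from anyV⇔ (u , from T-∧ (vu , from T-not ¬du)))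

  live-∪ : ∀ X y v → Live (X ∪ ⁅ y ⁆) v → Live X v
  live-∪ X y v l = let (¬dv , u , vu , ¬du) = live⁻ (X ∪ ⁅ y ⁆) v l
    in live⁺ X v u (¬dv ∘ dominated-∪ X y v) vu (¬du ∘ dominated-∪ X y u)

  live-∅ : ∀ v u → Adj v u → Live ∅ v
  live-∅ v u vu = live⁺ ∅ v u (¬dominated-∅ v) vu (¬dominated-∅ u)

  killed-dominated : ∀ X y v → T (dom G y v) → Live X v → Killed X y v
  killed-dominated X y v yv l = l , λ l′ → proj₁ (live⁻ (X ∪ ⁅ y ⁆) v l′) (dominated-new X y v yv)

  playable⁻ : ∀ X x → Playable X x → ∃ λ v → T (dom G x v) × Live X v
  playable⁻ X x p = let (v , t) = to anyV⇔ p in v , to (T-∧ {dom G x v}) t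

  playable⁺ : ∀ X x → Live X x → Playable X x
  playable⁺ X x l = from anyV⇔ (x , from T-∧ (dom-refl x , l))

  liveCount : Subset n → ℕ
  liveCount X = count (inBigComp G X) (allFin n)

  liveCount≤n : ∀ X → liveCount X ≤ n
  liveCount≤n X = ≤-trans (count≤length _ (allFin n)) (≤-reflexive (length-tabulate id))

  liveCount-drop : ∀ X y ds → Unique ds → All (Killed X y) ds → liveCount (X ∪ ⁅ y ⁆) + length ds ≤ liveCount X
  liveCount-drop X y ds uniq = count+length≤count _≟_ (live-∪ X y) (allFin n) ds uniq (λ {d} _ → ∈-allFin d)

  move-kills-one : ∀ X x → Playable X x → liveCount (X ∪ ⁅ x ⁆) + 1 ≤ liveCount X
  move-kills-one X x p = let (v , xv , live-v) = playable⁻ X x p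
    in liveCount-drop X x (v ∷ []) ([] ∷ []) (killed-dominated X x v xv live-v ∷ [])

  ResidueIsMatching : Subset n → Set
  ResidueIsMatching X = ∀ v u w → ¬ Dominated X v →
    Adj v u → ¬ Dominated X u → Adj v w → ¬ Dominated X w → u ≡ w

  residueIsMatching-∪ : ∀ X y → ResidueIsMatching X → ResidueIsMatching (X ∪ ⁅ y ⁆)
  residueIsMatching-∪ X y m v u w ¬dv vu ¬du vw ¬dw =
    m v u w (¬dv ∘ dominated-∪ X y v) vu (¬du ∘ dominated-∪ X y u) vw (¬dw ∘ dominated-∪ X y w)

  move-kills-two : ∀ X x → ResidueIsMatching X → Playable X x → liveCount (X ∪ ⁅ x ⁆) + 2 ≤ liveCount X
  move-kills-two X x m p with playable⁻ X x p
  ... | v , xv , live-v with live⁻ X v live-v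
  ... | ¬dv , u , vu , ¬du = liveCount-drop X x (v ∷ u ∷ []) ((Adj⇒≢ vu ∷ []) ∷ [] ∷ [])
    (killed-dominated X x v xv live-v ∷ (live⁺ X u v ¬du (Adj-sym vu) ¬dv , partner-dies) ∷ [])
    where
    partner-dies : ¬ Live (X ∪ ⁅ x ⁆) u
    partner-dies l with live⁻ (X ∪ ⁅ x ⁆) u l
    ... | _ , y , uy , ¬dy with refl ← m u v y ¬du (Adj-sym vu) ¬dv uy (¬dy ∘ dominated-∪ X x y) =
      ¬dy (dominated-new X x v xv)

  record Fork (X : Subset n) : Set where
    constructor fork
    field
      centre left right : Fin n
      ¬dominated-centre : ¬ Dominated X centre
      centre-left       : Adj centre left
      ¬dominated-left   : ¬ Dominated X left
      centre-right      : Adj centre right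
      ¬dominated-right  : ¬ Dominated X right
      left≢right        : ¬ left ≡ right

  residueIsMatching-or-fork : ∀ X → ResidueIsMatching X ⊎ Fork X
  residueIsMatching-or-fork X with any? (λ v → any? (λ u → any? (λ w →
      ¬? (T? (inN G X v)) ×-dec T? (adj G v u) ×-dec ¬? (T? (inN G X u)) ×-dec
      T? (adj G v w) ×-dec ¬? (T? (inN G X w)) ×-dec ¬? (u ≟ w))))
  ... | yes (v , u , w , ¬dv , vu , ¬du , vw , ¬dw , u≢w) = inj₂ (fork v u w ¬dv vu ¬du vw ¬dw u≢w)
  ... | no ¬fork = inj₁ λ v u w ¬dv vu ¬du vw ¬dw →
    decidable-stable (u ≟ w) (λ u≢w → ¬fork (v , u , w , ¬dv , vu , ¬du , vw , ¬dw , u≢w))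

  fork-centre-live : ∀ X (F : Fork X) → Live X (Fork.centre F)
  fork-centre-live X (fork c l _ ¬dc cl ¬dl _ _ _) = live⁺ X c l ¬dc cl ¬dl

  fork-centre-kills-three : ∀ X (F : Fork X) → liveCount (X ∪ ⁅ Fork.centre F ⁆) + 3 ≤ liveCount X
  fork-centre-kills-three X F@(fork c l r ¬dc cl ¬dl cr ¬dr l≢r) =
    liveCount-drop X c (c ∷ l ∷ r ∷ []) ((Adj⇒≢ cl ∷ Adj⇒≢ cr ∷ []) ∷ (l≢r ∷ []) ∷ [] ∷ [])
      ( killed-dominated X c c (dom-refl c) (fork-centre-live X F)
      ∷ killed-dominated X c l (dom-adj c l cl) (live⁺ X l c ¬dl (Adj-sym cl) ¬dc)
      ∷ killed-dominated X c r (dom-adj c r cr) (live⁺ X r c ¬dr (Adj-sym cr) ¬dc)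
      ∷ [])

  -- Bounds on the game value

  playableList-sound : ∀ X → All (Playable X) (playableList G X)
  playableList-sound X = All.tabulate λ x∈ → proj₂ (∈-filter⁻ (λ x → T? (playable G X x)) {xs = allFin n} x∈)

  playableList-complete : ∀ X x → Playable X x → x ∈ playableList G X
  playableList-complete X x = ∈-filter⁺ (λ x → T? (playable G X x)) (∈-allFin x)

  value-suc-preserves : (P : ℕ → Set) → ∀ f p X → P 0 →
    (∀ x → Playable X x → P (suc (value G f (other p) (X ∪ ⁅ x ⁆)))) → P (value G (suc f) p X)
  value-suc-preserves P f p X P0 Pmove with playableList G X | playableList-sound X
  ... | []     | _        = P0
  ... | x ∷ xs | px ∷ pxs = opt-preserves (P ∘ suc) p (Pmove x px) (All.map⁺ (All.map (λ {y} → Pmove y) pxs))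

  value-suc-positive : ∀ f p X x → Playable X x → 0 < value G (suc f) p X
  value-suc-positive f p X x px with playableList G X | playableList-complete X x px
  ... | _ ∷ _ | _ = s≤s z≤n

  value-suc-Dominator-≤ : ∀ f X y → Playable X y →
    value G (suc f) Dominator X ≤ suc (value G f Staller (X ∪ ⁅ y ⁆))
  value-suc-Dominator-≤ f X y py with playableList G X | playableList-complete X y py
  ... | x ∷ xs | y∈ = s≤s (opt-Dominator-≤ (next x) (map next xs) (∈-map⁺ next y∈))
    where
    next : Fin n → ℕ
    next z = value G f Staller (X ∪ ⁅ z ⁆)

  double-suc-≤ : ∀ {k a b} → 2 * k ≤ a → a + 2 ≤ b → 2 * suc k ≤ b
  double-suc-≤ {k} {a} {b} 2k≤a a+2≤b = begin
    2 * suc k  ≡⟨ *-suc 2 k ⟩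
    2 + 2 * k  ≡⟨ +-comm 2 (2 * k) ⟩
    2 * k + 2  ≤⟨ +-monoˡ-≤ 2 2k≤a ⟩
    a + 2      ≤⟨ a+2≤b ⟩
    b          ∎
    where open ≤-Reasoning

  value-matching : ∀ f p X → ResidueIsMatching X → 2 * value G f p X ≤ liveCount X
  value-matching zero    p X m = z≤n
  value-matching (suc f) p X m = value-suc-preserves (λ k → 2 * k ≤ liveCount X) f p X z≤n λ x px →
    double-suc-≤ (value-matching f (other p) (X ∪ ⁅ x ⁆) (residueIsMatching-∪ X x m)) (move-kills-two X x m px)

  mutual
    value-Dominator : ∀ f X → 2 * value G f Dominator X ≤ liveCount X
    value-Dominator zero    X = z≤n
    value-Dominator (suc f) X with residueIsMatching-or-fork X
    ... | inj₁ m = value-matching (suc f) Dominator X m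
    ... | inj₂ F = ≤-trans
      (value-Dominator-move f X (Fork.centre F) (playable⁺ X (Fork.centre F) (fork-centre-live X F)))
      (fork-centre-kills-three X F)

    value-Dominator-move : ∀ f X y → Playable X y →
      2 * value G (suc f) Dominator X ≤ liveCount (X ∪ ⁅ y ⁆) + 3
    value-Dominator-move f X y py = ≤-trans (*-monoʳ-≤ 2 (value-suc-Dominator-≤ f X y py))
      (double-suc-≤ (value-Staller f (X ∪ ⁅ y ⁆)) (≤-reflexive (sym (+-suc (liveCount (X ∪ ⁅ y ⁆)) 2))))

    value-Staller : ∀ f X → 2 * value G f Staller X ≤ suc (liveCount X)
    value-Staller zero    X = z≤n
    value-Staller (suc f) X = value-suc-preserves (λ k → 2 * k ≤ suc (liveCount X)) f Staller X z≤n λ x px →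
      double-suc-≤ (value-Dominator f (X ∪ ⁅ x ⁆))
        (≤-trans (≤-reflexive (+-suc (liveCount (X ∪ ⁅ x ⁆)) 1)) (s≤s (move-kills-one X x px)))

  value-Dominator-opening : ∀ f X y → Playable X y → liveCount (X ∪ ⁅ y ⁆) + 4 ≤ liveCount X →
    2 * value G (suc f) Dominator X < liveCount X
  value-Dominator-opening f X y py kills-four = ≤-trans
    (s≤s (value-Dominator-move f X y py))
    (≤-trans (≤-reflexive (sym (+-suc (liveCount (X ∪ ⁅ y ⁆)) 3))) kills-four)

  ιg-bound : 2 * ιg G ≤ n
  ιg-bound = ≤-trans (value-Dominator n ∅) (liveCount≤n ∅)

  -- Leaves of acyclic graphs

  walk-preserves : (P : Fin n → Set) → (∀ {x y} → P x → Adj x y → P y) → ∀ {a v} → Walk G a v → P a → P v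
  walk-preserves P closed here        Pa = Pa
  walk-preserves P closed (step ab w) Pa = walk-preserves P closed w (closed Pa ab)

  walk-edge : ∀ {u v} → Walk G u v → ¬ u ≡ v → ∃ λ w → Adj u w
  walk-edge here        u≢u = ⊥-elim (u≢u refl)
  walk-edge (step uw _) _   = _ , uw

  closed-set-covers : Connected G → ∀ {a} (vs : List (Fin n)) → a ∈ vs →
    (∀ {x y} → x ∈ vs → Adj x y → y ∈ vs) → n ≤ length vs
  closed-set-covers connected {a} vs a∈vs closed = ≤-trans
    (≤-reflexive (sym (length-tabulate id)))
    (unique-⊆⇒length≤ _≟_ (allFin⁺ n) (λ {v} _ → walk-preserves (_∈ vs) closed (connected a v) a∈vs))

  unique⇒length≤n : ∀ {vs : List (Fin n)} → Unique vs → length vs ≤ n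
  unique⇒length≤n uniq =
    ≤-trans (unique-⊆⇒length≤ _≟_ uniq (λ {v} _ → ∈-allFin v)) (≤-reflexive (length-tabulate id))

  closedChain-takeThrough : ∀ {u w p rest} (w∈rest : w ∈ rest) → Linked Adj (p ∷ rest) → Adj w u →
    closedChain G u (p ∷ takeThrough w∈rest)
  closedChain-takeThrough (here refl)    (pw ∷ _)      wu = pw , wu
  closedChain-takeThrough (there w∈rest) (px ∷ linked) wu = px , closedChain-takeThrough w∈rest linked wu

  NoLeaf : Set
  NoLeaf = ∀ u p → Adj u p → ∃ λ w → Adj u w × ¬ w ≡ p

  extend-path : Acyclic G → NoLeaf → ∀ {u p rest} → Unique (u ∷ p ∷ rest) → Linked Adj (u ∷ p ∷ rest) →
    ∃ λ w → Unique (w ∷ u ∷ p ∷ rest) × Linked Adj (w ∷ u ∷ p ∷ rest)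
  extend-path acyclic no-leaf {u} {p} {rest} uniq linked@(up ∷ linked-rest) with no-leaf u p up
  ... | w , uw , w≢p = w , ¬Any⇒All¬ _ w∉path ∷ uniq , Adj-sym uw ∷ linked
    where
    w∉path : w ∉ u ∷ p ∷ rest
    w∉path (here refl)            = Adj⇒≢ uw refl
    w∉path (there (here refl))    = w≢p refl
    w∉path (there (there w∈rest)) = acyclic
      ( u ∷ p ∷ takeThrough w∈rest
      , s≤s (s≤s (takeThrough-nonempty w∈rest))
      , take⁺ (3 + toℕ (Any.index w∈rest)) uniq
      , up , closedChain-takeThrough w∈rest linked-rest (Adj-sym uw))

  long-paths : Acyclic G → NoLeaf → ∀ {a b} → Adj a b → ∀ k →
    ∃₂ λ u p → ∃ λ rest → length rest ≡ k × Unique (u ∷ p ∷ rest) × Linked Adj (u ∷ p ∷ rest)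
  long-paths acyclic no-leaf {a} {b} ab zero = a , b , [] , refl , (Adj⇒≢ ab ∷ []) ∷ [] ∷ [] , ab ∷ [-]
  long-paths acyclic no-leaf ab (suc k) with long-paths acyclic no-leaf ab k
  ... | u , p , rest , refl , uniq , linked with extend-path acyclic no-leaf uniq linked
  ... | w , uniq′ , linked′ = w , u , p ∷ rest , refl , uniq′ , linked′

  record Leaf : Set where
    field
      leaf stem : Fin n
      leaf-stem : Adj leaf stem
      only-stem : ∀ x → Adj leaf x → x ≡ stem

  other-neighbour? : ∀ u p → Dec (∃ λ x → Adj u x × ¬ x ≡ p)
  other-neighbour? u p = any? (λ x → T? (adj G u x) ×-dec ¬? (x ≟ p))

  leaf-or-noLeaf : Leaf ⊎ NoLeaf
  leaf-or-noLeaf with any? (λ a → any? (λ b → T? (adj G a b) ×-dec ¬? (other-neighbour? a b)))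
  ... | yes (a , b , ab , ¬other) = inj₁ record
    { leaf = a ; stem = b ; leaf-stem = ab
    ; only-stem = λ x ax → decidable-stable (x ≟ b) (λ x≢b → ¬other (x , ax , x≢b)) }
  ... | no ¬leaf = inj₂ λ u p up → decidable-stable (other-neighbour? u p) (λ ¬other → ¬leaf (u , p , up , ¬other))

  leaf-exists : Acyclic G → ∀ {a b} → Adj a b → Leaf
  leaf-exists acyclic ab with leaf-or-noLeaf
  ... | inj₁ leaf    = leaf
  ... | inj₂ no-leaf with long-paths acyclic no-leaf ab n
  ... | _ , _ , _ , length≡n , uniq , _ =
    ⊥-elim (1+n≰n (≤-trans (n≤1+n _) (subst (λ l → suc (suc l) ≤ n) length≡n (unique⇒length≤n uniq))))

  -- Strong openings in trees

  neighbour? : ∀ {P : Fin n → Set} → Decidable P → ∀ v → (∃ λ w → Adj v w × P w) ⊎ (∀ w → Adj v w → ¬ P w)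
  neighbour? P? v with any? (λ w → T? (adj G v w) ×-dec P? w)
  ... | yes found = inj₁ found
  ... | no none   = inj₂ λ w vw pw → none (w , vw , pw)

  StrongOpening : Set
  StrongOpening = ∃ λ c → Playable ∅ c × liveCount (∅ ∪ ⁅ c ⁆) + 4 ≤ liveCount ∅

  opening-kills-neighbour : ∀ c v → Adj c v → Killed ∅ c v
  opening-kills-neighbour c v cv = killed-dominated ∅ c v (dom-adj c v cv) (live-∅ v c (Adj-sym cv))

  opening-kills-itself : ∀ c v → Adj c v → Killed ∅ c c
  opening-kills-itself c v cv = killed-dominated ∅ c c (dom-refl c) (live-∅ c v cv)

  star-opening : ∀ c x y z → Adj c x → Adj c y → Adj c z → ¬ x ≡ y → ¬ x ≡ z → ¬ y ≡ z → StrongOpening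
  star-opening c x y z cx cy cz x≢y x≢z y≢z = c , playable⁺ ∅ c (live-∅ c x cx) ,
    liveCount-drop ∅ c (c ∷ x ∷ y ∷ z ∷ [])
      ((Adj⇒≢ cx ∷ Adj⇒≢ cy ∷ Adj⇒≢ cz ∷ []) ∷ (x≢y ∷ x≢z ∷ []) ∷ (y≢z ∷ []) ∷ [] ∷ [])
      ( opening-kills-itself c x cx
      ∷ opening-kills-neighbour c x cx ∷ opening-kills-neighbour c y cy ∷ opening-kills-neighbour c z cz ∷ [])

  module _ (L : Leaf) where
    open Leaf L renaming (leaf to a; stem to b)

    path-opening : ∀ c d → Adj b c → ¬ c ≡ a → Adj c d → ¬ d ≡ b → StrongOpening
    path-opening c d bc c≢a cd d≢b = c , playable⁺ ∅ c (live-∅ c d cd) ,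
      liveCount-drop ∅ c (a ∷ b ∷ c ∷ d ∷ [])
        ((Adj⇒≢ leaf-stem ∷ c≢a ∘ sym ∷ a≢d ∷ []) ∷ (Adj⇒≢ bc ∷ d≢b ∘ sym ∷ []) ∷ (Adj⇒≢ cd ∷ []) ∷ [] ∷ [])
        ( (live-∅ a b leaf-stem , leaf-dies)
        ∷ opening-kills-neighbour c b (Adj-sym bc)
        ∷ opening-kills-itself c d cd
        ∷ opening-kills-neighbour c d cd
        ∷ [])
      where
      a≢d : ¬ a ≡ d
      a≢d refl with refl ← only-stem c (Adj-sym cd) = Adj⇒≢ bc refl
      leaf-dies : ¬ Live (∅ ∪ ⁅ c ⁆) a
      leaf-dies l with live⁻ (∅ ∪ ⁅ c ⁆) a l
      ... | _ , u , au , ¬du with refl ← only-stem u au = ¬du (dominated-new ∅ c b (dom-adj c b (Adj-sym bc)))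

    leaf-opening : Connected G → 3 < n → StrongOpening
    leaf-opening connected 3<n with neighbour? (λ c → ¬? (c ≟ a)) b
    ... | inj₂ b-only-a =
      ⊥-elim (<⇒≱ 3<n (≤-trans (closed-set-covers connected (a ∷ b ∷ []) (here refl) closed) (s≤s (s≤s z≤n))))
      where
      closed : ∀ {x y} → x ∈ a ∷ b ∷ [] → Adj x y → y ∈ a ∷ b ∷ []
      closed (here refl)         ay = there (here (only-stem _ ay))
      closed (there (here refl)) by = here (decidable-stable (_ ≟ a) (b-only-a _ by))
    ... | inj₁ (c , bc , c≢a) with neighbour? (λ d → ¬? (d ≟ b)) c
    ...   | inj₁ (d , cd , d≢b) = path-opening c d bc c≢a cd d≢b
    ...   | inj₂ c-only-b with neighbour? (λ x → ¬? (x ≟ a) ×-dec ¬? (x ≟ c)) b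
    ...     | inj₁ (x , bx , x≢a , x≢c) =
      star-opening b a c x (Adj-sym leaf-stem) bc bx (c≢a ∘ sym) (x≢a ∘ sym) (x≢c ∘ sym)
    ...     | inj₂ b-only-ac = ⊥-elim (<⇒≱ 3<n (closed-set-covers connected (a ∷ b ∷ c ∷ []) (here refl) closed))
      where
      closed : ∀ {x y} → x ∈ a ∷ b ∷ c ∷ [] → Adj x y → y ∈ a ∷ b ∷ c ∷ []
      closed (here refl) ay = there (here (only-stem _ ay))
      closed {y = y} (there (here refl)) by with y ≟ a | y ≟ c
      ... | yes y≡a | _       = here y≡a
      ... | no _    | yes y≡c = there (there (here y≡c))
      ... | no y≢a  | no y≢c  = ⊥-elim (b-only-ac y by (y≢a , y≢c))
      closed (there (there (here refl))) cy = there (here (decidable-stable (_ ≟ b) (c-only-b _ cy)))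

tree-2ιg<order : ∀ {n} (G : Graph n) → IsTree G → 3 < n → 2 * ιg G < n
tree-2ιg<order {1} G _ (s≤s ())
tree-2ιg<order {suc (suc m)} G tree 3<n with walk-edge G (IsTree.connected tree 0F 1F) (λ ())
... | _ , edge with leaf-opening G (leaf-exists G (IsTree.acyclic tree) edge) (IsTree.connected tree) 3<n
... | c , c-playable , kills-four =
  ≤-trans (value-Dominator-opening G (suc m) ∅ c c-playable kills-four) (liveCount≤n G ∅)

tree-2ιg≢order : ∀ {n} (G : Graph n) → IsTree G → ¬ n ≡ 2 → ¬ 2 * ιg G ≡ n
tree-2ιg≢order {0} G tree _ with () ← IsTree.nonempty tree
tree-2ιg≢order {1} G _ _ = even≢odd (ιg G) 0
tree-2ιg≢order {2} G _ n≢2 = ⊥-elim (n≢2 refl)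
tree-2ιg≢order {3} G _ _ = even≢odd (ιg G) 1
tree-2ιg≢order {suc (suc (suc (suc _)))} G tree _ = <⇒≢ (tree-2ιg<order G tree (s≤s (s≤s (s≤s (s≤s z≤n)))))

order-2-edge : (G : Graph 2) → Connected G → Adj G 0F 1F
order-2-edge G connected with connected 0F 1F
... | step {w = 0F} self-loop _ = ⊥-elim (Adj⇒≢ G self-loop refl)
... | step {w = 1F} edge _ = edge

edge⇒≅K₂ : (G : Graph 2) → Adj G 0F 1F → G ≅ K₂
edge⇒≅K₂ G edge = mk⤖ {to = id} (id , (λ y → y , id)) , same-adj
  where
  same-adj : ∀ u v → adj G u v ≡ adj K₂ u v
  same-adj 0F 0F = adj-irrefl G 0F
  same-adj 0F 1F = to T-≡ edge
  same-adj 1F 0F = trans (adj-sym G 1F 0F) (to T-≡ edge)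
  same-adj 1F 1F = adj-irrefl G 1F

edge⇒2ιg≡2 : (G : Graph 2) → Adj G 0F 1F → 2 * ιg G ≡ 2
edge⇒2ιg≡2 G edge = ≤-antisym (ιg-bound G)
  (*-monoʳ-≤ 2 (value-suc-positive G 1 Dominator ∅ 0F (playable⁺ G ∅ 0F (live-∅ G 0F 1F edge))))

≅K₂⇒order≡2 : ∀ {n} (G : Graph n) → G ≅ K₂ → n ≡ 2
≅K₂⇒order≡2 G (f , _) = ↔⇒≡ (⤖⇒↔ f)

corollary4p1 : (n : ℕ) (T : Graph n) → IsTree T →
    (2 * ιg T ≤ n) × ((2 * ιg T ≡ n) ⇔ (T ≅ K₂))
corollary4p1 n G tree with n ≟ℕ 2
... | yes refl = ιg-bound G , mk⇔ (λ _ → edge⇒≅K₂ G edge) (λ _ → edge⇒2ιg≡2 G edge)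
  where
  edge : Adj G 0F 1F
  edge = order-2-edge G (IsTree.connected tree)
... | no n≢2 = ιg-bound G , mk⇔ (⊥-elim ∘ tree-2ιg≢order G tree n≢2) (⊥-elim ∘ n≢2 ∘ ≅K₂⇒order≡2 G)
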